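{- Let $b\ge2$, $s\ge1$ and $u\ge0$ be integers and let $\mathbf{e}=(e_1,\dots,e_s)\in\mathbb{N}^s$. If a $(u,\mathbf{e},s)$-sequence in base $b$ is given, then for every integer $m\ge u$ one can construct a $(u,m,\mathbf{e}',s+1)$-net in base $b$, where $\mathbf{e}'=(1,e_1,\dots,e_s)\in\mathbb{N}^{s+1}$.
   Context: $\mathbb{N}$ denotes the positive integers, $\lambda_s$ Lebesgue measure. An elementary interval in base $b$ is $J=\prod_{i=1}^s[a_ib^{ -d_i},(a_i+1)b^{ -d_i})$ with integers $d_i\ge0$, $0\le a_i<b^{d_i}$. For integers $0\le u\le m$ and $\mathbf{e}=(e_1,\dots,e_s)\in\mathbb{N}^s$, a set of $b^m$ points in $[0,1)^s$ is a $(u,m,\mathbf{e},s)$-net in base $b$ if every elementary interval $J$ in base $b$ with $\lambda_s(J)\ge b^{u-m}$ and $e_i\mid d_i$ for all $i$ contains exactly $b^m\lambda_s(J)$ of the points. For $\mathbf{x}\in[0,1]^s$, $[\mathbf{x}]_{b,m}$ denotes the coordinatewise $m$-digit truncation of $\mathbf{x}$ in base $b$. For an integer $u\ge0$, a sequence $\mathbf{x}_0,\mathbf{x}_1,\dots$ in $[0,1]^s$ is a $(u,\mathbf{e},s)$-sequence in base $b$ if for all integers $k\ge0$ and $m>u$ the points $[\mathbf{x}_n]_{b,m}$ with $kb^m\le n<(k+1)b^m$ form a $(u,m,\mathbf{e},s)$-net in base $b$. -}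

module Defs where

open import Data.Nat using (ℕ; zero; suc; _+_; _*_; _^_; _≤_; _<_; _≤ᵇ_; _<ᵇ_)
open import Data.Nat.Divisibility using (_∣_)
open import Data.Fin using (Fin; zero; suc; toℕ)
open import Data.Bool using (Bool; true; false; _∧_; if_then_else_)
open import Data.Product using (Σ; _×_)
open import Relation.Binary.PropositionalEquality using (_≡_)

sumFin : (s : ℕ) → (Fin s → ℕ) → ℕ
sumFin zero    f = 0
sumFin (suc s) f = f zero + sumFin s (λ i → f (suc i))

allFinᵇ : (s : ℕ) → (Fin s → Bool) → Bool
allFinᵇ zero    f = true
allFinᵇ (suc s) f = f zero ∧ allFinᵇ s (λ i → f (suc i))

countFin : (n : ℕ) → (Fin n → Bool) → ℕ
countFin zero    f = 0
countFin (suc n) f = (if f zero then 1 else 0) + countFin n (λ i → f (suc i))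

-- A point of [0,1)^s with b-adic coordinates of precision p is represented by
-- numerators N : Fin s → ℕ, the i-th coordinate being N i / b^p.
-- Membership in the elementary interval prod_i [a_i b^{-d_i}, (a_i+1) b^{-d_i}):
--   a_i / b^{d_i} ≤ N_i / b^p < (a_i + 1) / b^{d_i}, cross-multiplied.
inElemᵇ : (b p s : ℕ) → (d a : Fin s → ℕ) → (N : Fin s → ℕ) → Bool
inElemᵇ b p s d a N =
  allFinᵇ s (λ i → (a i * b ^ p ≤ᵇ N i * b ^ d i) ∧ (N i * b ^ d i <ᵇ suc (a i) * b ^ p))

-- (u,m,e,s)-net in base b, for a multiset of b^m points of [0,1)^s whose
-- coordinates are b-adic rationals of precision p (point j has numerators P j).
-- Condition λ(J) = b^{-Σ d_i} ≥ b^{u-m} is  Σ d_i + u ≤ m  (as b ≥ 2),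
-- and b^m λ(J) = b^{m - Σ d_i}, i.e. count * b^{Σ d_i} = b^m.
IsNet : (b u m s : ℕ) → (e : Fin s → ℕ) → (p : ℕ) → (P : Fin (b ^ m) → Fin s → ℕ) → Set
IsNet b u m s e p P =
  u ≤ m ×
  ((j : Fin (b ^ m)) (i : Fin s) → P j i < b ^ p) ×
  ((d a : Fin s → ℕ) →
     ((i : Fin s) → e i ∣ d i) →
     ((i : Fin s) → a i < b ^ d i) →
     sumFin s d + u ≤ m →
     countFin (b ^ m) (λ j → inElemᵇ b p s d a (P j)) * b ^ sumFin s d ≡ b ^ m)

-- A point of [0,1]^s given by b-adic digit expansions: coordinate i has digits
-- x i 0, x i 1, ... (most significant first).
Digits : ℕ → Set
Digits b = ℕ → Fin b

-- Numerator of the m-digit truncation [x]_{b,m} (value = truncDigits x m / b^m).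
truncDigits : {b : ℕ} → Digits b → ℕ → ℕ
truncDigits {b} x zero    = 0
truncDigits {b} x (suc m) = truncDigits x m * b + toℕ (x m)

IsSequence : (b u s : ℕ) → (e : Fin s → ℕ) → (x : ℕ → Fin s → Digits b) → Set
IsSequence b u s e x =
  (k m : ℕ) → u < m →
  IsNet b u m s e m (λ j i → truncDigits (x (k * b ^ m + toℕ j) i) m)

module Submission where

-- From a (u,e,s)-sequence x₀, x₁, … in base b and m ≥ u we take the
-- b^m points of precision m
--     P_j = ( j / b^m , [x_j]_{b,m} ),        0 ≤ j < b^m.
-- Let J = [a₀ b^{-d₀}, (a₀+1) b^{-d₀}) × J' be admissible for (u,m,(1,e),s+1),
-- i.e. d₀ + Σ d' + u ≤ m, and put m' = m − d₀, K = b^{m'}.  The first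
-- coordinate of P_j lies in its factor exactly when a₀K ≤ j < (a₀+1)K, so the
-- points in J are those [x_{a₀K+k}]_{b,m}, 0 ≤ k < K, lying in J'.  All depths
-- of J' are ≤ m', so truncating to m or to m' digits does not change membership;
-- and [x_{a₀K+k}]_{b,m'} (0 ≤ k < K) is the a₀-th block of length b^{m'} of the
-- sequence, which meets J' in b^{m'-Σd'} points (it is a (u,m',e,s)-net when
-- u < m'; when u = m', J' is the whole cube).  So J holds b^{m-d₀-Σd'} points.

open import Defs
open import Data.Nat
  using (ℕ; zero; suc; _+_; _*_; _∸_; _^_; _≤_; _<_; _≤ᵇ_; _<ᵇ_; z≤n; s≤s; s≤s⁻¹; NonZero; >-nonZero; _<?_)
open import Data.Nat.Properties
open import Data.Nat.Tactic.RingSolver using (solve-∀)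
open import Algebra.Properties.CommutativeSemigroup *-commutativeSemigroup using (xy∙z≈xz∙y; x∙yz≈xz∙y)
open import Data.Nat.Divisibility using (_∣_)
open import Data.Fin using (Fin; zero; suc; toℕ)
open import Data.Fin.Properties using (toℕ<n)
open import Data.Bool using (Bool; true; false; _∧_; if_then_else_)
open import Data.Product using (Σ; _,_; proj₂)
open import Data.Vec.Functional using (_∷_; tail)
open import Relation.Nullary using (¬_; yes; no; contradiction)
open import Relation.Nullary.Reflects using (Reflects; ofʸ; ofⁿ)
open import Relation.Binary.PropositionalEquality

-- Two Booleans reflecting logically equivalent propositions are equal.  This
-- turns arithmetic equivalences into equalities of the Boolean tests of IsNet.
reflects-≡ : ∀ {ℓ ℓ′} {A : Set ℓ} {B : Set ℓ′} {x y : Bool} →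
  Reflects A x → Reflects B y → (A → B) → (B → A) → x ≡ y
reflects-≡ (ofʸ _)  (ofʸ _)  _ _ = refl
reflects-≡ (ofʸ a)  (ofⁿ ¬b) f _ = contradiction (f a) ¬b
reflects-≡ (ofⁿ ¬a) (ofʸ b)  _ g = contradiction (g b) ¬a
reflects-≡ (ofⁿ _)  (ofⁿ _)  _ _ = refl

reflects-true : ∀ {ℓ} {A : Set ℓ} {x : Bool} → Reflects A x → A → x ≡ true
reflects-true (ofʸ _)  _ = refl
reflects-true (ofⁿ ¬a) a = contradiction a ¬a

reflects-false : ∀ {ℓ} {A : Set ℓ} {x : Bool} → Reflects A x → ¬ A → x ≡ false
reflects-false (ofʸ a) ¬a = contradiction a ¬a
reflects-false (ofⁿ _) _  = refl

inRange : ℕ → ℕ → ℕ → Bool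
inRange lo hi N = (lo ≤ᵇ N) ∧ (N <ᵇ hi)

inRange-below : ∀ {lo} hi {N} → N < lo → inRange lo hi N ≡ false
inRange-below {lo} hi {N} N<lo rewrite reflects-false (≤ᵇ-reflects-≤ lo N) (<⇒≱ N<lo) = refl

inRange-above : ∀ lo {hi N} → hi ≤ N → inRange lo hi N ≡ false
inRange-above lo {hi} {N} hi≤N rewrite reflects-false (<ᵇ-reflects-< N hi) (≤⇒≯ hi≤N) with lo ≤ᵇ N
... | true  = refl
... | false = refl

inRange-inside : ∀ {lo hi N} → lo ≤ N → N < hi → inRange lo hi N ≡ true
inRange-inside {lo} {hi} {N} lo≤N N<hi
  rewrite reflects-true (≤ᵇ-reflects-≤ lo N) lo≤N | reflects-true (<ᵇ-reflects-< N hi) N<hi = refl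

module _ {B r : ℕ} .{{_ : NonZero B}} (r<B : r < B) where

  ≤-appendDigit : ∀ {X Y} → X ≤ Y → X * B ≤ Y * B + r
  ≤-appendDigit {X} {Y} X≤Y = ≤-trans (*-monoˡ-≤ B X≤Y) (m≤m+n (Y * B) r)

  ≤-dropDigit : ∀ {X Y} → X * B ≤ Y * B + r → X ≤ Y
  ≤-dropDigit {X} {Y} h = s≤s⁻¹ (*-cancelʳ-< B X (suc Y) (begin-strict
      X * B      ≤⟨ h ⟩
      Y * B + r  <⟨ +-monoʳ-< (Y * B) r<B ⟩
      Y * B + B  ≡⟨ +-comm (Y * B) B ⟩
      suc Y * B  ∎))
    where open ≤-Reasoning

  <-appendDigit : ∀ {Y Z} → Y < Z → Y * B + r < Z * B
  <-appendDigit {Y} {Z} Y<Z = begin-strict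
      Y * B + r  <⟨ +-monoʳ-< (Y * B) r<B ⟩
      Y * B + B  ≡⟨ +-comm (Y * B) B ⟩
      suc Y * B  ≤⟨ *-monoˡ-≤ B Y<Z ⟩
      Z * B      ∎
    where open ≤-Reasoning

  <-dropDigit : ∀ {Y Z} → Y * B + r < Z * B → Y < Z
  <-dropDigit {Y} {Z} h = *-cancelʳ-< B Y Z (≤-<-trans (m≤m+n (Y * B) r) h)

  inRange-dropDigit : ∀ X Y Z → inRange (X * B) (Z * B) (Y * B + r) ≡ inRange X Z Y
  inRange-dropDigit X Y Z = cong₂ _∧_
    (reflects-≡ (≤ᵇ-reflects-≤ _ _) (≤ᵇ-reflects-≤ X Y) ≤-dropDigit ≤-appendDigit)
    (reflects-≡ (<ᵇ-reflects-< _ _) (<ᵇ-reflects-< Y Z) <-dropDigit <-appendDigit)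

count : ℕ → (ℕ → Bool) → ℕ
count zero    g = 0
count (suc n) g = (if g 0 then 1 else 0) + count n (λ k → g (suc k))

countFin-toℕ : ∀ n g → countFin n (λ j → g (toℕ j)) ≡ count n g
countFin-toℕ zero    g = refl
countFin-toℕ (suc n) g = cong ((if g 0 then 1 else 0) +_) (countFin-toℕ n (λ k → g (suc k)))

count-cong : ∀ n {g h} → (∀ k → k < n → g k ≡ h k) → count n g ≡ count n h
count-cong zero    eq = refl
count-cong (suc n) eq = cong₂ _+_ (cong (λ v → if v then 1 else 0) (eq 0 (s≤s z≤n)))
  (count-cong n (λ k k<n → eq (suc k) (s≤s k<n)))

count-+ : ∀ A B g → count (A + B) g ≡ count A g + count B (λ k → g (A + k))
count-+ zero    B g = refl
count-+ (suc A) B g = trans (cong ((if g 0 then 1 else 0) +_) (count-+ A B (λ k → g (suc k))))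
  (sym (+-assoc (if g 0 then 1 else 0) _ _))

count-all : ∀ n {g} → (∀ k → k < n → g k ≡ true) → count n g ≡ n
count-all zero    eq = refl
count-all (suc n) eq rewrite eq 0 (s≤s z≤n) = cong suc (count-all n (λ k k<n → eq (suc k) (s≤s k<n)))

count-none : ∀ n {g} → (∀ k → k < n → g k ≡ false) → count n g ≡ 0
count-none zero    eq = refl
count-none (suc n) eq rewrite eq 0 (s≤s z≤n) = count-none n (λ k k<n → eq (suc k) (s≤s k<n))

count-window : ∀ lo L N (h : ℕ → Bool) → lo + L ≤ N →
  count N (λ k → inRange lo (lo + L) k ∧ h k) ≡ count L (λ k → h (lo + k))
count-window lo L N h le = begin
    count N g
  ≡⟨ cong (λ n → count n g) (sym (m+[n∸m]≡n le)) ⟩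
    count (lo + L + R) g
  ≡⟨ count-+ (lo + L) R g ⟩
    count (lo + L) g + count R (λ k → g (lo + L + k))
  ≡⟨ cong₂ _+_ (count-+ lo L g) (count-none R (λ k _ → cong (_∧ h (lo + L + k)) (inRange-above lo (m≤m+n (lo + L) k)))) ⟩
    count lo g + count L (λ k → g (lo + k)) + 0
  ≡⟨ cong₂ (λ c c′ → c + c′ + 0) (count-none lo (λ k k<lo → cong (_∧ h k) (inRange-below (lo + L) k<lo))) (count-cong L inside) ⟩
    count L (λ k → h (lo + k)) + 0
  ≡⟨ +-identityʳ _ ⟩
    count L (λ k → h (lo + k))
  ∎
  where
  open ≡-Reasoning
  g : ℕ → Bool
  g k = inRange lo (lo + L) k ∧ h k
  R : ℕ
  R = N ∸ (lo + L)
  inside : ∀ k → k < L → g (lo + k) ≡ h (lo + k)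
  inside k k<L = cong (_∧ h (lo + k)) (inRange-inside (m≤m+n lo k) (+-monoʳ-< lo k<L))

sumFin-≤ : ∀ s (d : Fin s → ℕ) i → d i ≤ sumFin s d
sumFin-≤ (suc s) d zero    = m≤m+n (d zero) _
sumFin-≤ (suc s) d (suc i) = ≤-trans (sumFin-≤ s (λ j → d (suc j)) i) (m≤n+m _ (d zero))

allFinᵇ-cong : ∀ s {f g : Fin s → Bool} → (∀ i → f i ≡ g i) → allFinᵇ s f ≡ allFinᵇ s g
allFinᵇ-cong zero    eq = refl
allFinᵇ-cong (suc s) eq = cong₂ _∧_ (eq zero) (allFinᵇ-cong s (λ i → eq (suc i)))

allFinᵇ-true : ∀ s {f : Fin s → Bool} → (∀ i → f i ≡ true) → allFinᵇ s f ≡ true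
allFinᵇ-true zero    eq = refl
allFinᵇ-true (suc s) eq rewrite eq zero = allFinᵇ-true s (λ i → eq (suc i))

module BAdic (b : ℕ) .{{_ : NonZero b}} where

  pow-split : ∀ {p d} → d ≤ p → b ^ p ≡ b ^ (p ∸ d) * b ^ d
  pow-split {p} {d} d≤p = trans (cong (b ^_) (sym (m∸n+n≡m d≤p))) (^-distribˡ-+-* b (p ∸ d) d)

  block-fits : ∀ {a d m} → d ≤ m → a < b ^ d → a * b ^ (m ∸ d) + b ^ (m ∸ d) ≤ b ^ m
  block-fits {a} {d} {m} d≤m a<b^d = begin
      a * K + K    ≡⟨ +-comm (a * K) K ⟩
      suc a * K    ≤⟨ *-monoˡ-≤ K a<b^d ⟩
      b ^ d * K    ≡⟨ *-comm (b ^ d) K ⟩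
      K * b ^ d    ≡⟨ pow-split d≤m ⟨
      b ^ m        ∎
    where
    open ≤-Reasoning
    K : ℕ
    K = b ^ (m ∸ d)

  truncDigits-< : (x : Digits b) → ∀ n → truncDigits x n < b ^ n
  truncDigits-< x zero    = s≤s z≤n
  truncDigits-< x (suc n) = ≤-trans (<-appendDigit (toℕ<n (x n)) (truncDigits-< x n)) (≤-reflexive (*-comm (b ^ n) b))

  truncDigits-+ : (x : Digits b) → ∀ p c →
    truncDigits x (p + c) ≡ truncDigits x p * b ^ c + truncDigits (λ n → x (p + n)) c
  truncDigits-+ x p zero    = trans (cong (truncDigits x) (+-identityʳ p)) (sym (trans (+-identityʳ _) (*-identityʳ _)))
  truncDigits-+ x p (suc c) rewrite +-suc p c | truncDigits-+ x p c =
    regroup (truncDigits x p) (b ^ c) (truncDigits (λ n → x (p + n)) c) b (toℕ (x (p + c)))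
    where
    regroup : ∀ T Bc R B r → (T * Bc + R) * B + r ≡ T * (B * Bc) + (R * B + r)
    regroup = solve-∀

  coordTest : ℕ → ℕ → ℕ → ℕ → Bool
  coordTest p d a N = inRange (a * b ^ p) (suc a * b ^ p) (N * b ^ d)

  coordTest-range : ∀ p d a N K → b ^ p ≡ K * b ^ d → coordTest p d a N ≡ inRange (a * K) (suc a * K) N
  coordTest-range p d a N K eq rewrite eq = begin
      inRange (a * (K * b ^ d)) (suc a * (K * b ^ d)) (N * b ^ d)
    ≡⟨ cong₂ (λ lo hi → inRange lo hi (N * b ^ d)) (sym (*-assoc a K _)) (sym (*-assoc (suc a) K _)) ⟩
      inRange (a * K * b ^ d) (suc a * K * b ^ d) (N * b ^ d)
    ≡⟨ cong (inRange (a * K * b ^ d) (suc a * K * b ^ d)) (sym (+-identityʳ _)) ⟩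
      inRange (a * K * b ^ d) (suc a * K * b ^ d) (N * b ^ d + 0)
    ≡⟨ inRange-dropDigit {{m^n≢0 b d}} (m^n>0 b d) (a * K) N (suc a * K) ⟩
      inRange (a * K) (suc a * K) N
    ∎
    where open ≡-Reasoning

  coordTest-truncate : (x : Digits b) → ∀ p c d a → d ≤ p →
    coordTest (p + c) d a (truncDigits x (p + c)) ≡ coordTest p d a (truncDigits x p)
  coordTest-truncate x p c d a d≤p = begin
      coordTest (p + c) d a (truncDigits x (p + c))
    ≡⟨ coordTest-range (p + c) d a _ (K * b ^ c) pow-p+c ⟩
      inRange (a * (K * b ^ c)) (suc a * (K * b ^ c)) (truncDigits x (p + c))
    ≡⟨ cong₃ (sym (*-assoc a K _)) (sym (*-assoc (suc a) K _)) (truncDigits-+ x p c) ⟩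
      inRange (a * K * b ^ c) (suc a * K * b ^ c) (truncDigits x p * b ^ c + R)
    ≡⟨ inRange-dropDigit {{m^n≢0 b c}} (truncDigits-< _ c) (a * K) (truncDigits x p) (suc a * K) ⟩
      inRange (a * K) (suc a * K) (truncDigits x p)
    ≡⟨ coordTest-range p d a _ K (pow-split d≤p) ⟨
      coordTest p d a (truncDigits x p)
    ∎
    where
    open ≡-Reasoning
    K : ℕ
    K = b ^ (p ∸ d)
    R : ℕ
    R = truncDigits (λ n → x (p + n)) c
    pow-p+c : b ^ (p + c) ≡ K * b ^ c * b ^ d
    pow-p+c = begin
      b ^ (p + c)        ≡⟨ ^-distribˡ-+-* b p c ⟩
      b ^ p * b ^ c      ≡⟨ cong (_* b ^ c) (pow-split d≤p) ⟩
      K * b ^ d * b ^ c  ≡⟨ xy∙z≈xz∙y K (b ^ d) (b ^ c) ⟩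
      K * b ^ c * b ^ d  ∎
    cong₃ : ∀ {x x′ y y′ z z′} → x ≡ x′ → y ≡ y′ → z ≡ z′ → inRange x y z ≡ inRange x′ y′ z′
    cong₃ refl refl refl = refl

  inElem-truncate : ∀ s (d a : Fin s → ℕ) (y : Fin s → Digits b) {p′ p} → p′ ≤ p → (∀ i → d i ≤ p′) →
    inElemᵇ b p s d a (λ i → truncDigits (y i) p) ≡ inElemᵇ b p′ s d a (λ i → truncDigits (y i) p′)
  inElem-truncate s d a y {p′} p′≤p d≤p′ with m≤n⇒∃[o]m+o≡n p′≤p
  ... | c , refl = allFinᵇ-cong s (λ i → coordTest-truncate (y i) p′ c (d i) (a i) (d≤p′ i))

  inElem-whole : ∀ s (d a N : Fin s → ℕ) p → sumFin s d ≡ 0 → (∀ i → a i < b ^ d i) →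
    (∀ i → N i < b ^ p) → inElemᵇ b p s d a N ≡ true
  inElem-whole s d a N p Σd≡0 a<b^d N<b^p = allFinᵇ-true s whole
    where
    whole : ∀ i → coordTest p (d i) (a i) (N i) ≡ true
    whole i with sumFin-≤ s d i | a<b^d i
    ... | d≤0 | a<b^d rewrite n≤0⇒n≡0 (≤-trans d≤0 (≤-reflexive Σd≡0)) | n≤0⇒n≡0 (s≤s⁻¹ a<b^d) =
      trans (coordTest-range p 0 0 (N i) (b ^ p) (sym (*-identityʳ _)))
            (inRange-inside z≤n (≤-trans (N<b^p i) (≤-reflexive (sym (+-identityʳ _)))))

  -- Each block x_{k b^{m′}}, …, x_{(k+1) b^{m′} − 1} of a (u,e,s)-sequence,
  -- truncated to m′ digits, meets every interval admissible for (u,m′,e,s) in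
  -- b^{m′ − Σd} points: for u < m′ this is the definition of a sequence, and
  -- otherwise Σd = 0 and the interval is the whole cube.
  block-count : ∀ {u s e} x → IsSequence b u s e x → ∀ k m′ (d a : Fin s → ℕ) →
    (∀ i → e i ∣ d i) → (∀ i → a i < b ^ d i) → sumFin s d + u ≤ m′ →
    count (b ^ m′) (λ j → inElemᵇ b m′ s d a (λ i → truncDigits (x (k * b ^ m′ + j) i) m′))
      * b ^ sumFin s d ≡ b ^ m′
  block-count {u} {s} x seq k m′ d a e∣d a<b^d adm with u <? m′
  ... | yes u<m′ = trans (cong (_* b ^ sumFin s d) (sym (countFin-toℕ (b ^ m′) _)))
                         (proj₂ (proj₂ (seq k m′ u<m′)) d a e∣d a<b^d adm)
  ... | no u≮m′ = begin
      count (b ^ m′) _ * b ^ sumFin s d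
    ≡⟨ cong₂ _*_ (count-all (b ^ m′) (λ j _ → inElem-whole s d a _ m′ Σd≡0 a<b^d (λ i → truncDigits-< _ m′)))
                 (cong (b ^_) Σd≡0) ⟩
      b ^ m′ * 1
    ≡⟨ *-identityʳ _ ⟩
      b ^ m′
    ∎
    where
    open ≡-Reasoning
    Σd≡0 : sumFin s d ≡ 0
    Σd≡0 = n≤0⇒n≡0 (+-cancelʳ-≤ u _ 0 (≤-trans adm (≮⇒≥ u≮m′)))

seqPoints : ∀ {b} s m → (ℕ → Fin s → Digits b) → Fin (b ^ m) → Fin (suc s) → ℕ
seqPoints s m x j = toℕ j ∷ (λ i → truncDigits (x (toℕ j) i) m)

module SequencePoints (b : ℕ) .{{_ : NonZero b}} where
  open BAdic b

  seqPoints-< : ∀ s m x (j : Fin (b ^ m)) i → seqPoints s m x j i < b ^ m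
  seqPoints-< s m x j zero    = toℕ<n j
  seqPoints-< s m x j (suc i) = truncDigits-< (x (toℕ j) i) m

  -- With K = b^{m−d₀}, the points P_j in [a₀b^{−d₀}, (a₀+1)b^{−d₀}) × J′ are
  -- those with a₀K ≤ j < (a₀+1)K, and [x_j]_{b,m} ∈ J′ iff [x_j]_{b,m−d₀} ∈ J′
  -- when J′ has depths ≤ m − d₀.
  seqPoints-count : ∀ s m x (d a : Fin (suc s) → ℕ) → d zero ≤ m → a zero < b ^ d zero →
    (∀ i → tail d i ≤ m ∸ d zero) →
    countFin (b ^ m) (λ j → inElemᵇ b m (suc s) d a (seqPoints s m x j))
      ≡ count (b ^ (m ∸ d zero)) (λ k → inElemᵇ b (m ∸ d zero) s (tail d) (tail a)
                (λ i → truncDigits (x (a zero * b ^ (m ∸ d zero) + k) i) (m ∸ d zero)))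
  seqPoints-count s m x d a d₀≤m a₀<b^d₀ d′≤m′ = begin
      countFin (b ^ m) (λ j → inElemᵇ b m (suc s) d a (seqPoints s m x j))
    ≡⟨ countFin-toℕ (b ^ m) (λ k → coordTest m (d zero) (a zero) k ∧ H m k) ⟩
      count (b ^ m) (λ k → coordTest m (d zero) (a zero) k ∧ H m k)
    ≡⟨ count-cong (b ^ m) (λ k _ → cong (_∧ H m k) (first-coordinate k)) ⟩
      count (b ^ m) (λ k → inRange lo (lo + K) k ∧ H m k)
    ≡⟨ count-window lo K (b ^ m) (H m) (block-fits d₀≤m a₀<b^d₀) ⟩
      count K (λ k → H m (lo + k))
    ≡⟨ count-cong K (λ k _ → inElem-truncate s (tail d) (tail a) (x (lo + k)) (m∸n≤m m (d zero)) d′≤m′) ⟩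
      count K (λ k → H m′ (lo + k))
    ∎
    where
    open ≡-Reasoning
    m′ K lo : ℕ
    m′ = m ∸ d zero
    K  = b ^ m′
    lo = a zero * K
    H : ℕ → ℕ → Bool
    H p k = inElemᵇ b p s (tail d) (tail a) (λ i → truncDigits (x k i) p)
    first-coordinate : ∀ k → coordTest m (d zero) (a zero) k ≡ inRange lo (lo + K) k
    first-coordinate k = trans (coordTest-range m (d zero) (a zero) k K (pow-split d₀≤m))
                               (cong (λ hi → inRange lo hi k) (+-comm K lo))

  seqPoints-net : ∀ {u s e} x → IsSequence b u s e x → ∀ {m} → u ≤ m →
    IsNet b u m (suc s) (1 ∷ e) m (seqPoints s m x)
  seqPoints-net {u} {s} {e} x seq {m} u≤m = u≤m , seqPoints-< s m x , net-count
    where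
    net-count : (d a : Fin (suc s) → ℕ) → (∀ i → (1 ∷ e) i ∣ d i) → (∀ i → a i < b ^ d i) →
      sumFin (suc s) d + u ≤ m →
      countFin (b ^ m) (λ j → inElemᵇ b m (suc s) d a (seqPoints s m x j)) * b ^ sumFin (suc s) d ≡ b ^ m
    net-count d a divides a<b^d adm = begin
        countFin (b ^ m) (λ j → inElemᵇ b m (suc s) d a (seqPoints s m x j)) * b ^ (d₀ + S)
      ≡⟨ cong₂ _*_ (seqPoints-count s m x d a d₀≤m (a<b^d zero) d′≤m′) (^-distribˡ-+-* b d₀ S) ⟩
        C * (b ^ d₀ * b ^ S)
      ≡⟨ x∙yz≈xz∙y C (b ^ d₀) (b ^ S) ⟩
        C * b ^ S * b ^ d₀
      ≡⟨ cong (_* b ^ d₀) (block-count x seq (a zero) m′ (tail d) (tail a) (λ i → divides (suc i)) (λ i → a<b^d (suc i)) adm′) ⟩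
        b ^ m′ * b ^ d₀
      ≡⟨ pow-split d₀≤m ⟨
        b ^ m
      ∎
      where
      open ≡-Reasoning
      d₀ S m′ C : ℕ
      d₀ = d zero
      S  = sumFin s (tail d)
      m′ = m ∸ d₀
      C  = count (b ^ m′) (λ k → inElemᵇ b m′ s (tail d) (tail a)
             (λ i → truncDigits (x (a zero * b ^ m′ + k) i) m′))
      d₀≤m : d₀ ≤ m
      d₀≤m = ≤-trans (≤-trans (m≤m+n d₀ S) (m≤m+n (d₀ + S) u)) adm
      adm′ : S + u ≤ m′
      adm′ = m+n≤o⇒m≤o∸n (S + u) (≤-trans (≤-reflexive (trans (+-comm (S + u) d₀) (sym (+-assoc d₀ S u)))) adm)
      d′≤m′ : ∀ i → tail d i ≤ m′
      d′≤m′ i = ≤-trans (≤-trans (sumFin-≤ s (tail d) i) (m≤m+n S u)) adm′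

-- The theorem: the points P_j of the given sequence are the required net.
proposition4 : (b s u : ℕ) → 2 ≤ b → 1 ≤ s → (e : Fin s → ℕ) → ((i : Fin s) → 1 ≤ e i) →
    (x : ℕ → Fin s → Digits b) → IsSequence b u s e x →
    (m : ℕ) → u ≤ m →
    Σ ℕ (λ p → Σ (Fin (b ^ m) → Fin (suc s) → ℕ) (λ P → IsNet b u m (suc s) (1 ∷ e) p P))
proposition4 b s u 2≤b _ e _ x seq m u≤m = m , seqPoints s m x , seqPoints-net x seq u≤m
  where
  instance
    b≢0 : NonZero b
    b≢0 = >-nonZero (≤-trans (s≤s z≤n) 2≤b)
  open SequencePoints b
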